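{- Let $\Gamma$ be a residually connected incidence geometry over $I=\{0,\dots,n-1\}$, $n\ge3$, satisfying $(B_1)$ and $(B_2)$ for $\{0,1\}$, with $\Gamma[0,1]$ not bipartite. Let $x,y,z$ be three elements of $\Gamma$ of pairwise different types, none equal to $0$ or $1$, and let $\{(x,P_x),(y,P_y),(z,P_z)\}$ be a flag of $\mathcal{P}(\Gamma)(0,1)$. Then $P_x\cap P_y\cap P_z\neq\emptyset$.
   Context: Standard notions: incidence geometry, flags, residues $\Gamma_x$, truncation $\Gamma[J]$, $S_i=t^{ -1}(i)$, $\sigma_0(x)$ = $0$-elements incident to $x$. $(B_1)$: $\Gamma[0,1]$ is the geometry of a simple graph (vertices = $0$-elements, edges = $1$-elements); $p\sim q$ denotes adjacency. $(B_2)$: for an edge $e$ and $x$ of type $\notin\{0,1\}$, $e*x$ iff $\sigma_0(e)\subseteq\sigma_0(x)$. For a connected graph $\mathcal{G}$ on $V$, $\pi(\mathcal{G})$ is the set of classes of "joined by an even walk" ($\{V\}$ if non-bipartite, colour classes if bipartite); $\bar P=V\setminus P$ if bipartite, $\bar P=P$ otherwise. $\mathcal{P}(\Gamma)(0,1)$: elements $(p,0)$, $(p,1)$ for $p\in S_0$ (types 0, 1) and $(x,P_x)$ for $x\in S_i$, $i\ge2$, $P_x\in\pi(\Gamma_x[0,1])$ (type $i$); incidence: $(x,P_x)*'(y,P_y)$ iff $x*y$ and $P_x\cap P_y\ne\emptyset$; $(p,0)*'(y,P_y)$ iff $p*y$, $p\in P_y$; $(q,1)*'(y,P_y)$ iff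 $q*y$, $q\in\bar P_y$; $(p,0)*'(q,1)$ iff $p\sim q$. -}

module Defs where

open import Data.Nat using (ℕ; zero; suc)
open import Data.Fin using (Fin; zero; suc)
open import Data.Bool using (Bool; true; false; not)
open import Data.Product using (Σ; ∃; ∃-syntax; _×_; _,_)
open import Data.Sum using (_⊎_)
open import Data.Empty using (⊥)
open import Relation.Nullary using (¬_)
open import Relation.Binary.PropositionalEquality using (_≡_; _≢_)
open import Level using (Level) renaming (suc to lsuc; zero to lzero)

record IncidenceGeometry (n : ℕ) : Set₁ where
  field
    X      : Set
    t      : X → Fin n
    _*_    : X → X → Set
    *-refl : ∀ a → a * a
    *-sym  : ∀ {a b} → a * b → b * a
    *-type : ∀ {a b} → t a ≡ t b → a * b → a ≡ b

  IsFlag : (X → Set) → Set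
  IsFlag F = ∀ a b → F a → F b → a * b

  TypeIn : (X → Set) → Fin n → Set
  TypeIn F i = ∃[ a ] (F a × t a ≡ i)

  IsChamber : (X → Set) → Set
  IsChamber C = IsFlag C × (∀ i → TypeIn C i)

  InResidue : (X → Set) → X → Set
  InResidue F a = (∀ b → F b → a * b) × ¬ TypeIn F (t a)

  Corank≥2 : (X → Set) → Set
  Corank≥2 F = Σ (Fin n) λ i → Σ (Fin n) λ j → i ≢ j × ¬ TypeIn F i × ¬ TypeIn F j

EveryFlagInChamber : ∀ {n} → IncidenceGeometry n → Set₁
EveryFlagInChamber Γ = ∀ F → IsFlag F → ∃[ C ] (IsChamber C × (∀ a → F a → C a))
  where open IncidenceGeometry Γ

data Chain {X : Set} (A : X → Set) (R : X → X → Set) : X → X → Set where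
  []   : ∀ {a} → Chain A R a a
  step : ∀ {a b c} → A b → R a b → Chain A R b c → Chain A R a c

Connected : {X : Set} → (A : X → Set) → (R : X → X → Set) → Set
Connected {X} A R = ∀ (a b : X) → A a → A b → Chain A R a b

ResiduallyConnected : ∀ {n} → IncidenceGeometry n → Set₁
ResiduallyConnected Γ = ∀ F → IsFlag F → Corank≥2 F → Connected (InResidue F) _*_
  where open IncidenceGeometry Γ

-- walks with their parity (false = even length, true = odd length)
data Walk {X : Set} (Adj : X → X → Set) : Bool → X → X → Set where
  nil  : ∀ {a} → Walk Adj false a a
  cons : ∀ {p a b c} → Adj a b → Walk Adj p b c → Walk Adj (not p) a c

EvenWalk : {X : Set} → (X → X → Set) → X → X → Set
EvenWalk Adj a b = Walk Adj false a b

Bipartite : {X : Set} → (X → X → Set) → Set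
Bipartite {X} Adj = Σ (X → Bool) λ c → ∀ a b → Adj a b → c a ≢ c b

-- P ∈ π(G): P is a class of the relation "joined by an even walk" on V
InPi : {X : Set} → (V : X → Set) → (Adj : X → X → Set) → (X → Set) → Set
InPi {X} V Adj P =
  Σ X λ p → V p × (∀ q → (P q → V q × EvenWalk Adj p q) × (V q × EvenWalk Adj p q → P q))

InBar : {X : Set} → (V : X → Set) → (Adj : X → X → Set) → (X → Set) → X → Set
InBar V Adj P q = (Bipartite Adj × V q × ¬ P q) ⊎ (¬ Bipartite Adj × P q)

-- The (0,1) conditions; types 0 and 1 exist since n = suc (suc k)

module _ {k : ℕ} (Γ : IncidenceGeometry (suc (suc k))) where
  open IncidenceGeometry Γ

  ty0 ty1 : Fin (suc (suc k))
  ty0 = zero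
  ty1 = suc zero

  _∼_ : X → X → Set
  p ∼ q = t p ≡ ty0 × t q ≡ ty0 × p ≢ q × ∃[ e ] (t e ≡ ty1 × e * p × e * q)

  -- (B1): Γ[0,1] is the geometry of a simple graph
  B1 : Set
  B1 = (∀ e → t e ≡ ty1 →
          ∃[ p ] ∃[ q ] (t p ≡ ty0 × t q ≡ ty0 × p ≢ q × e * p × e * q ×
             (∀ r → t r ≡ ty0 → e * r → r ≡ p ⊎ r ≡ q)))
     × (∀ e e' p q → t e ≡ ty1 → t e' ≡ ty1 → t p ≡ ty0 → t q ≡ ty0 → p ≢ q →
          e * p → e * q → e' * p → e' * q → e ≡ e')

  σ₀ : X → X → Set
  σ₀ x p = t p ≡ ty0 × p * x

  NotZO : X → Set
  NotZO x = t x ≢ ty0 × t x ≢ ty1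

  B2 : Set
  B2 = ∀ e x → t e ≡ ty1 → NotZO x →
         (e * x → ∀ p → σ₀ e p → σ₀ x p) × ((∀ p → σ₀ e p → σ₀ x p) → e * x)

  NotBipartite01 : Set
  NotBipartite01 = ¬ Bipartite _∼_

  Adjₓ : X → X → X → Set
  Adjₓ x p q = σ₀ x p × σ₀ x q × p ≢ q ×
               ∃[ e ] (t e ≡ ty1 × e * x × e * p × e * q)

  data PElem : Set₁ where
    pt0 : (p : X) → t p ≡ ty0 → PElem
    pt1 : (p : X) → t p ≡ ty0 → PElem
    big : (x : X) → NotZO x → (P : X → Set) → InPi (σ₀ x) (Adjₓ x) P → PElem

  _*'_ : PElem → PElem → Set
  pt0 p _ *' pt0 q _ = p ≡ q
  pt0 p _ *' pt1 q _ = p ∼ q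
  pt0 p _ *' big y _ P _ = p * y × P p
  pt1 p _ *' pt0 q _ = q ∼ p
  pt1 p _ *' pt1 q _ = p ≡ q
  pt1 q _ *' big y _ P _ = q * y × InBar (σ₀ y) (Adjₓ y) P q
  big x _ P _ *' pt0 p _ = p * x × P p
  big x _ P _ *' pt1 q _ = q * x × InBar (σ₀ x) (Adjₓ x) P q
  big x _ P _ *' big y _ Q _ = x * y × ∃[ q ] (P q × Q q)

{-# OPTIONS --safe #-}
module Submission where

-- Extend {x, y, z} to a chamber: by (B1) and (B2) its 1-element is an edge pq of
-- Γ_x[0,1], Γ_y[0,1] and Γ_z[0,1] at once. For a pair, say x and y, residual connectedness
-- makes the {0,1}-truncation of the residue Γ_{x,y} connected, so a point a ∈ P_x ∩ P_y is
-- joined to p by a walk whose edges lie in both Γ_x[0,1] and Γ_y[0,1]; according to its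
-- parity, p or q lies in P_x ∩ P_y. Two of the three pairs make the same choice, and that
-- endpoint lies in P_x ∩ P_y ∩ P_z.

open import Defs
open import Data.Nat using (ℕ; _+_)
open import Data.Product using (∃-syntax; _×_)
open import Relation.Binary.PropositionalEquality using (_≢_)

open import Data.Nat using (suc)
open import Level using (0ℓ)
open import Data.Bool using (Bool; true; false; not; _xor_)
open import Data.Bool.Properties using (not-involutive)
open import Data.Empty using (⊥-elim)
open import Data.Fin using (Fin; punchIn; punchOut; _≟_)
open import Data.Fin.Properties using (punchIn-punchOut)
open import Data.Product using (_,_; proj₁; proj₂)
open import Data.Sum using (_⊎_; inj₁; inj₂; [_,_]; map₁)
open import Function using (_∘_; id)
open import Relation.Binary.Core using (Rel; _⇒_)
open import Relation.Binary.PropositionalEquality using (_≡_; refl; sym; trans; subst; cong)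
open import Relation.Nullary using (¬_; yes; no)
open import Relation.Nullary.Decidable using (_⊎-dec_)
open import Relation.Unary using (Pred; Decidable; _⊆_; ｛_｝; _∪_; _∩_)

private variable
  Y : Set
  a b c : Y
  s s′ : Bool

module _ {R : Rel Y 0ℓ} where

  _++ʷ_ : Walk R s a b → Walk R s′ b c → Walk R (s xor s′) a c
  nil ++ʷ w′ = w′
  cons {p = false} r w ++ʷ w′ = cons r (w ++ʷ w′)
  _++ʷ_ {c = c} (cons {p = true} {a = a} r w) w′ =
    subst (λ s → Walk R s a c) (not-involutive _) (cons r (w ++ʷ w′))

  _++ᶜ_ : {A : Pred Y 0ℓ} → Chain A R a b → Chain A R b c → Chain A R a c
  [] ++ᶜ w′ = w′
  step Ab r w ++ᶜ w′ = step Ab r (w ++ᶜ w′)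

  Chain-map : {A B : Pred Y 0ℓ} → A ⊆ B → Chain A R a b → Chain B R a b
  Chain-map A⊆B [] = []
  Chain-map A⊆B (step Ab r w) = step (A⊆B Ab) r (Chain-map A⊆B w)

Walk-map : {R S : Rel Y 0ℓ} → R ⇒ S → Walk R s a b → Walk S s a b
Walk-map R⇒S nil = nil
Walk-map R⇒S (cons r w) = cons (R⇒S r) (Walk-map R⇒S w)

module _ {V P : Pred Y 0ℓ} {Adj : Rel Y 0ℓ} where

  InPi⊆ : InPi V Adj P → P ⊆ V
  InPi⊆ (_ , _ , class) Pq = proj₁ (proj₁ (class _) Pq)

  InPi-closed-under-even-walks : InPi V Adj P → P a → EvenWalk Adj a b → V b → P b
  InPi-closed-under-even-walks (_ , _ , class) Pa w Vb =
    proj₂ (class _) (Vb , proj₂ (proj₁ (class _) Pa) ++ʷ w)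

common-point-of-pairs : {A B C : Pred Y 0ℓ} {p q : Y} →
  (A ∩ B) p ⊎ (A ∩ B) q → (B ∩ C) p ⊎ (B ∩ C) q → (A ∩ C) p ⊎ (A ∩ C) q →
  ∃[ r ] (A ∩ B ∩ C) r
common-point-of-pairs (inj₁ (Ap , Bp)) (inj₁ (_ , Cp)) _ = _ , Ap , Bp , Cp
common-point-of-pairs (inj₂ (Aq , Bq)) (inj₂ (_ , Cq)) _ = _ , Aq , Bq , Cq
common-point-of-pairs (inj₁ (Ap , Bp)) (inj₂ _) (inj₁ (_ , Cp)) = _ , Ap , Bp , Cp
common-point-of-pairs (inj₂ (Aq , Bq)) (inj₁ _) (inj₂ (_ , Cq)) = _ , Aq , Bq , Cq
common-point-of-pairs (inj₁ _) (inj₂ (Bq , Cq)) (inj₂ (Aq , _)) = _ , Aq , Bq , Cq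
common-point-of-pairs (inj₂ _) (inj₁ (Bp , Cp)) (inj₁ (Ap , _)) = _ , Ap , Bp , Cp

module Flags {n : ℕ} (Γ : IncidenceGeometry n) where
  open IncidenceGeometry Γ

  IncidentToAll : Pred X 0ℓ → Pred X 0ℓ
  IncidentToAll F c = ∀ b → F b → c * b

  IncidentToAll-antitone : ∀ {F G c} → G ⊆ F → IncidentToAll F c → IncidentToAll G c
  IncidentToAll-antitone G⊆F cF b = cF b ∘ G⊆F

  IncidentToAll-∪｛｝ : ∀ {F u c} → IncidentToAll F c → c * u → IncidentToAll (F ∪ ｛ u ｝) c
  IncidentToAll-∪｛｝ cF c*u b (inj₁ Fb) = cF b Fb
  IncidentToAll-∪｛｝ cF c*u _ (inj₂ refl) = c*u

  IsFlag-｛｝ : ∀ x → IsFlag ｛ x ｝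
  IsFlag-｛｝ x _ _ refl refl = *-refl x

  IsFlag-∪｛｝ : ∀ {F u} → IsFlag F → IncidentToAll F u → IsFlag (F ∪ ｛ u ｝)
  IsFlag-∪｛｝ flF uF a b (inj₁ Fa) (inj₁ Fb) = flF a b Fa Fb
  IsFlag-∪｛｝ flF uF a _ (inj₁ Fa) (inj₂ refl) = *-sym (uF a Fa)
  IsFlag-∪｛｝ flF uF _ b (inj₂ refl) (inj₁ Fb) = uF b Fb
  IsFlag-∪｛｝ flF uF _ _ (inj₂ refl) (inj₂ refl) = *-refl _

module TruncatedResidue {n : ℕ} (Γ : IncidenceGeometry n)
  (efc : EveryFlagInChamber Γ) (rc : ResiduallyConnected Γ)
  {J : Pred (Fin n) 0ℓ} (J? : Decidable J)
  {j₀ j₁ : Fin n} (j₀≢j₁ : j₀ ≢ j₁) (J-j₀ : J j₀) (J-j₁ : J j₁) where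
  open IncidenceGeometry Γ
  open Flags Γ

  InResidue[J] : Pred X 0ℓ → Pred X 0ℓ
  InResidue[J] F c = IncidentToAll F c × J (t c)

  AvoidsJ : Pred X 0ℓ → Set
  AvoidsJ F = ∀ a → F a → ¬ J (t a)

  Cotype⊆J∪Im : ∀ {d} → Pred X 0ℓ → (Fin d → Fin n) → Set
  Cotype⊆J∪Im F f = ∀ i → ¬ TypeIn F i → J i ⊎ ∃[ j ] (f j ≡ i)

  private variable
    F : Pred X 0ℓ
    u u′ : X

  AvoidsJ⇒¬TypeIn : AvoidsJ F → ∀ {i} → J i → ¬ TypeIn F i
  AvoidsJ⇒¬TypeIn avF Ji (b , Fb , tb≡i) = avF b Fb (subst J (sym tb≡i) Ji)

  InResidue[J]⇒InResidue : AvoidsJ F → InResidue[J] F ⊆ InResidue F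
  InResidue[J]⇒InResidue avF (cF , Jc) = cF , AvoidsJ⇒¬TypeIn avF Jc

  AvoidsJ⇒Corank≥2 : AvoidsJ F → Corank≥2 F
  AvoidsJ⇒Corank≥2 avF = j₀ , j₁ , j₀≢j₁ , AvoidsJ⇒¬TypeIn avF J-j₀ , AvoidsJ⇒¬TypeIn avF J-j₁

  common-J-neighbour : IsFlag F → InResidue F u → InResidue F u′ → u * u′ →
                       ∃[ c ] (InResidue[J] F c × c * u × c * u′)
  common-J-neighbour {F} {u} {u′} flF (uF , _) (u′F , _) u*u′
    with efc ((F ∪ ｛ u ｝) ∪ ｛ u′ ｝)
             (IsFlag-∪｛｝ (IsFlag-∪｛｝ flF uF) (IncidentToAll-∪｛｝ u′F (*-sym u*u′)))
  ... | C , (flC , typesC) , F′⊆C with typesC j₀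
  ... | c , Cc , tc≡j₀ =
    c , (IncidentToAll-antitone (inj₁ ∘ inj₁) c*C , subst J (sym tc≡j₀) J-j₀)
      , c*C u (inj₁ (inj₂ refl)) , c*C u′ (inj₂ refl)
    where
    c*C : IncidentToAll ((F ∪ ｛ u ｝) ∪ ｛ u′ ｝) c
    c*C b F′b = flC c b Cc (F′⊆C b F′b)

  Cotype⊆J∪Im-∪｛｝ : ∀ {d} {f : Fin (suc d) → Fin n} {j} →
    Cotype⊆J∪Im F f → f j ≡ t u → Cotype⊆J∪Im (F ∪ ｛ u ｝) (f ∘ punchIn j)
  Cotype⊆J∪Im-∪｛｝ {F} {u} {f = f} {j} cov fj≡tu i i∉F∪u
    with cov i (λ (b , Fb , tb≡i) → i∉F∪u (b , inj₁ Fb , tb≡i))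
  ... | inj₁ Ji = inj₁ Ji
  ... | inj₂ (j′ , fj′≡i) = inj₂ (punchOut j≢j′ , trans (cong f (punchIn-punchOut j≢j′)) fj′≡i)
    where
    j≢j′ : j ≢ j′
    j≢j′ j≡j′ = i∉F∪u (u , inj₂ refl , trans (sym fj≡tu) (trans (cong f j≡j′) fj′≡i))

  -- Induction on d, where f lists the types outside J missing from F: each step of a chain
  -- in Γ_F is rerouted through J-elements inside Γ_{F ∪ {u}}, which misses one type fewer.
  residue[J]-connected′ : ∀ d (f : Fin d → Fin n) → Cotype⊆J∪Im F f → IsFlag F → AvoidsJ F →
                          Connected (InResidue[J] F) _*_
  connect-via : ∀ d (f : Fin d → Fin n) → Cotype⊆J∪Im F f → IsFlag F → AvoidsJ F →
                InResidue F u → InResidue[J] F a → InResidue[J] F b → a * u → b * u →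
                Chain (InResidue[J] F) _*_ a b

  residue[J]-connected′ {F} d f cov flF avF a b Ra Rb =
    reroute (rc F flF (AvoidsJ⇒Corank≥2 avF) a b Ra′ (InResidue[J]⇒InResidue avF Rb))
            Ra′ Ra (*-refl a)
    where
    Ra′ = InResidue[J]⇒InResidue avF Ra
    reroute : ∀ {u a′} → Chain (InResidue F) _*_ u b → InResidue F u →
              InResidue[J] F a′ → a′ * u → Chain (InResidue[J] F) _*_ a′ b
    reroute [] _ Ra′ a′*b = step Rb a′*b []
    reroute (step Ru′ u*u′ rest) Ru Ra′ a′*u with common-J-neighbour flF Ru Ru′ u*u′
    ... | c , Rc , c*u , c*u′ =
      connect-via d f cov flF avF Ru Ra′ Rc a′*u c*u ++ᶜ reroute rest Ru′ Rc c*u′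

  connect-via {u = u} d f cov flF avF (uF , tu∉F) Ra Rb a*u b*u with J? (t u)
  ... | yes Ju = step (uF , Ju) a*u (step Rb (*-sym b*u) [])
  ... | no ¬Ju with cov (t u) tu∉F
  ...   | inj₁ Ju = ⊥-elim (¬Ju Ju)
  connect-via {F} {u} (suc d) f cov flF avF (uF , _) (aF , Ja) (bF , Jb) a*u b*u
    | no ¬Ju | inj₂ (j , fj≡tu) =
    Chain-map (λ (cF∪u , Jc) → IncidentToAll-antitone inj₁ cF∪u , Jc)
      (residue[J]-connected′ d (f ∘ punchIn j) (Cotype⊆J∪Im-∪｛｝ cov fj≡tu)
        (IsFlag-∪｛｝ flF uF) avF∪u _ _
        (IncidentToAll-∪｛｝ aF a*u , Ja) (IncidentToAll-∪｛｝ bF b*u , Jb))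
    where
    avF∪u : AvoidsJ (F ∪ ｛ u ｝)
    avF∪u a (inj₁ Fa) = avF a Fa
    avF∪u _ (inj₂ refl) = ¬Ju

  residue[J]-connected : IsFlag F → AvoidsJ F → Connected (InResidue[J] F) _*_
  residue[J]-connected = residue[J]-connected′ n id (λ i _ → inj₂ (i , refl))

module ZeroOne {k : ℕ} (Γ : IncidenceGeometry (suc (suc k)))
  (efc : EveryFlagInChamber Γ) (rc : ResiduallyConnected Γ) (b1 : B1 Γ) where
  open IncidenceGeometry Γ
  open Flags Γ

  Is01 : Pred (Fin (suc (suc k))) 0ℓ
  Is01 i = i ≡ ty0 Γ ⊎ i ≡ ty1 Γ

  Is01? : Decidable Is01
  Is01? i = i ≟ ty0 Γ ⊎-dec i ≟ ty1 Γ

  open TruncatedResidue Γ efc rc Is01? (λ ()) (inj₁ refl) (inj₂ refl)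

  σ₀[_] : Pred X 0ℓ → Pred X 0ℓ
  σ₀[ F ] p = t p ≡ ty0 Γ × IncidentToAll F p

  Adj[_] : Pred X 0ℓ → Rel X 0ℓ
  Adj[ F ] p q = σ₀[ F ] p × σ₀[ F ] q × p ≢ q ×
                 ∃[ e ] (t e ≡ ty1 Γ × IncidentToAll F e × e * p × e * q)

  private variable
    F G : Pred X 0ℓ
    e p q v : X
    P : Pred X 0ℓ

  NotZO⇒¬Is01 : NotZO Γ v → ¬ Is01 (t v)
  NotZO⇒¬Is01 (≢0 , ≢1) = [ ≢0 , ≢1 ]

  σ₀[]⇒σ₀ : F v → σ₀[ F ] p → σ₀ Γ v p
  σ₀[]⇒σ₀ Fv (tp , pF) = tp , pF _ Fv

  Adj[]⇒Adjₓ : F v → Adj[ F ] ⇒ Adjₓ Γ v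
  Adj[]⇒Adjₓ Fv (σp , σq , p≢q , e , te , eF , e*p , e*q) =
    σ₀[]⇒σ₀ Fv σp , σ₀[]⇒σ₀ Fv σq , p≢q , e , te , eF _ Fv , e*p , e*q

  Adj[]-antitone : G ⊆ F → Adj[ F ] ⇒ Adj[ G ]
  Adj[]-antitone G⊆F ((tp , pF) , (tq , qF) , p≢q , e , te , eF , e*p , e*q) =
    (tp , IncidentToAll-antitone G⊆F pF) , (tq , IncidentToAll-antitone G⊆F qF) , p≢q ,
    e , te , IncidentToAll-antitone G⊆F eF , e*p , e*q

  -- B1 is what makes equality of two vertices on a common edge decidable.
  ≡-or-≢-on-edge : t e ≡ ty1 Γ → t p ≡ ty0 Γ → t q ≡ ty0 Γ → e * p → e * q → p ≡ q ⊎ p ≢ q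
  ≡-or-≢-on-edge {e} {p} {q} te tp tq e*p e*q with proj₁ b1 e te
  ... | r , r′ , _ , _ , r≢r′ , _ , _ , endpoints
    with endpoints p tp e*p | endpoints q tq e*q
  ... | inj₁ refl | inj₁ refl = inj₁ refl
  ... | inj₂ refl | inj₂ refl = inj₁ refl
  ... | inj₁ refl | inj₂ refl = inj₂ r≢r′
  ... | inj₂ refl | inj₁ refl = inj₂ (r≢r′ ∘ sym)

  Chain⇒Walk : σ₀[ F ] a → Chain (InResidue[J] F) _*_ a b → t b ≡ ty0 Γ →
               ∃[ s ] Walk Adj[ F ] s a b
  Chain⇒Walk-via : σ₀[ F ] a → t e ≡ ty1 Γ → IncidentToAll F e → a * e →
                   Chain (InResidue[J] F) _*_ e b → t b ≡ ty0 Γ → ∃[ s ] Walk Adj[ F ] s a b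

  Chain⇒Walk _ [] _ = false , nil
  Chain⇒Walk (ta , aF) (step (cF , inj₁ tc) a*c rest) tb with *-type (trans ta (sym tc)) a*c
  ... | refl = Chain⇒Walk (tc , cF) rest tb
  Chain⇒Walk σa (step (eF , inj₂ te) a*e rest) tb = Chain⇒Walk-via σa te eF a*e rest tb

  Chain⇒Walk-via _ te _ _ [] tb with () ← trans (sym tb) te
  Chain⇒Walk-via σa te eF a*e (step (cF , inj₂ tc) e*c rest) tb with *-type (trans te (sym tc)) e*c
  ... | refl = Chain⇒Walk-via σa tc cF a*e rest tb
  Chain⇒Walk-via σa@(ta , _) te eF a*e (step (cF , inj₁ tc) e*c rest) tb
    with ≡-or-≢-on-edge te ta tc (*-sym a*e) e*c | Chain⇒Walk (tc , cF) rest tb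
  ... | inj₁ refl | walk = walk
  ... | inj₂ a≢c | s , w = not s , cons (σa , (tc , cF) , a≢c , _ , te , eF , *-sym a*e , e*c) w

  residue-graph-walk : IsFlag F → (∀ v → F v → NotZO Γ v) → σ₀[ F ] a → σ₀[ F ] b →
                       ∃[ s ] Walk Adj[ F ] s a b
  residue-graph-walk flF nzF σa@(ta , aF) (tb , bF) =
    Chain⇒Walk σa (residue[J]-connected flF (λ v → NotZO⇒¬Is01 ∘ nzF v) _ _
                                        (aF , inj₁ ta) (bF , inj₁ tb)) tb

  residue-graph-has-edge : B2 Γ → IsFlag F → (∀ v → F v → NotZO Γ v) → ∃[ p ] ∃[ q ] Adj[ F ] p q
  residue-graph-has-edge {F} b2 flF nzF with efc F flF
  ... | C , (flC , typesC) , F⊆C with typesC (ty1 Γ)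
  ... | e , Ce , te with proj₁ b1 e te
  ... | p , q , tp , tq , p≢q , e*p , e*q , _ =
    p , q , (tp , endpoint-σ₀ e*p tp) , (tq , endpoint-σ₀ e*q tq) , p≢q , e , te , eF , e*p , e*q
    where
    eF : IncidentToAll F e
    eF v Fv = flC e v Ce (F⊆C v Fv)
    endpoint-σ₀ : ∀ {r} → e * r → t r ≡ ty0 Γ → IncidentToAll F r
    endpoint-σ₀ {r} e*r tr v Fv = proj₂ (proj₁ (b2 e v te (nzF v Fv)) (eF v Fv) r (tr , *-sym e*r))

  InPi-closed-under-residue-walks : F v → InPi (σ₀ Γ v) (Adjₓ Γ v) P → P a →
                                    EvenWalk Adj[ F ] a b → σ₀[ F ] b → P b
  InPi-closed-under-residue-walks Fv P∈π Pa w σb =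
    InPi-closed-under-even-walks P∈π Pa (Walk-map (Adj[]⇒Adjₓ Fv) w) (σ₀[]⇒σ₀ Fv σb)

  common-endpoint : ∀ {x y Px Py} → x * y → NotZO Γ x → NotZO Γ y →
    InPi (σ₀ Γ x) (Adjₓ Γ x) Px → InPi (σ₀ Γ y) (Adjₓ Γ y) Py → (Px ∩ Py) a →
    Adj[ ｛ x ｝ ∪ ｛ y ｝ ] p q → (Px ∩ Py) p ⊎ (Px ∩ Py) q
  common-endpoint {a} {p} {q} {x} {y} x*y nx ny Px∈π Py∈π (Pxa , Pya) pq@(σp , σq , _)
    with residue-graph-walk (IsFlag-∪｛｝ (IsFlag-｛｝ x) λ { _ refl → *-sym x*y }) nzxy σa σp
    where
    nzxy : ∀ v → (｛ x ｝ ∪ ｛ y ｝) v → NotZO Γ v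
    nzxy _ (inj₁ refl) = nx
    nzxy _ (inj₂ refl) = ny
    σa : σ₀[ ｛ x ｝ ∪ ｛ y ｝ ] a
    σa = proj₁ (InPi⊆ Px∈π Pxa) , λ { _ (inj₁ refl) → proj₂ (InPi⊆ Px∈π Pxa)
                                   ; _ (inj₂ refl) → proj₂ (InPi⊆ Py∈π Pya) }
  ... | false , w = inj₁ ( InPi-closed-under-residue-walks (inj₁ refl) Px∈π Pxa w σp
                         , InPi-closed-under-residue-walks (inj₂ refl) Py∈π Pya w σp)
  ... | true , w = inj₂ ( InPi-closed-under-residue-walks (inj₁ refl) Px∈π Pxa w′ σq
                        , InPi-closed-under-residue-walks (inj₂ refl) Py∈π Pya w′ σq)
    where
    w′ = w ++ʷ cons pq nil

lemma3p7 : (m : ℕ) (Γ : IncidenceGeometry (3 + m)) →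
    EveryFlagInChamber Γ → ResiduallyConnected Γ →
    B1 Γ → B2 Γ → NotBipartite01 Γ →
    (x y z : IncidenceGeometry.X Γ) →
    IncidenceGeometry.t Γ x ≢ IncidenceGeometry.t Γ y →
    IncidenceGeometry.t Γ y ≢ IncidenceGeometry.t Γ z →
    IncidenceGeometry.t Γ x ≢ IncidenceGeometry.t Γ z →
    (hx : NotZO Γ x) (hy : NotZO Γ y) (hz : NotZO Γ z) →
    (Px Py Pz : IncidenceGeometry.X Γ → Set) →
    (cx : InPi (σ₀ Γ x) (Adjₓ Γ x) Px) →
    (cy : InPi (σ₀ Γ y) (Adjₓ Γ y) Py) →
    (cz : InPi (σ₀ Γ z) (Adjₓ Γ z) Pz) →
    _*'_ Γ (big x hx Px cx) (big y hy Py cy) →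
    _*'_ Γ (big y hy Py cy) (big z hz Pz cz) →
    _*'_ Γ (big x hx Px cx) (big z hz Pz cz) →
    ∃[ q ] (Px q × Py q × Pz q)
lemma3p7 m Γ efc rc b1 b2 _ x y z _ _ _ hx hy hz Px Py Pz cx cy cz
  (x*y , a , Pxya) (y*z , b , Pyzb) (x*z , c , Pxzc) =
  let p , q , pq = residue-graph-has-edge b2 flag nz in
  common-point-of-pairs
    (common-endpoint x*y hx hy cx cy Pxya (Adj[]-antitone inj₁ pq))
    (common-endpoint y*z hy hz cy cz Pyzb (Adj[]-antitone (map₁ inj₂) pq))
    (common-endpoint x*z hx hz cx cz Pxzc (Adj[]-antitone (map₁ inj₁) pq))
  where
  open IncidenceGeometry Γ
  open Flags Γ
  open ZeroOne Γ efc rc b1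

  flag : IsFlag ((｛ x ｝ ∪ ｛ y ｝) ∪ ｛ z ｝)
  flag = IsFlag-∪｛｝ (IsFlag-∪｛｝ (IsFlag-｛｝ x) λ { _ refl → *-sym x*y })
                      (IncidentToAll-∪｛｝ (λ { _ refl → *-sym x*z }) (*-sym y*z))

  nz : ∀ v → ((｛ x ｝ ∪ ｛ y ｝) ∪ ｛ z ｝) v → NotZO Γ v
  nz _ (inj₁ (inj₁ refl)) = hx
  nz _ (inj₁ (inj₂ refl)) = hy
  nz _ (inj₂ refl) = hz
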